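{- Let $A\in\mathcal A_n$ with Kupisch series $[c_0,\dots,c_{n-1}]$. Then the directed graph $\tau(A)$ with vertex set $\{0,\dots,n\}$ and a directed edge $i+c_i\to i$ for each $0\le i<n$ is a tree rooted at the vertex $n$.
   Context: $K$ is an algebraically closed field. A connected linear Nakayama algebra with $m$ simple modules is $KQ/I$ with $Q$ the linear quiver $0\to1\to\cdots\to m-1$ and $I$ an admissible ideal; its Kupisch series $[c_0,\dots,c_{m-1}]$, $c_i=\dim_K e_iA$, satisfies $c_{i+1}+1\ge c_i\ge 2$ for $0\le i<m-1$ and $c_{m-1}=1$, and determines the algebra up to isomorphism. $\mathcal A_n$ denotes the set of ordered products $A=A_1\times\cdots\times A_k$ ($k\ge 1$; the order of the factors matters) of connected linear Nakayama algebras with $n$ simple modules in total. The Kupisch series of such $A$ is the concatenation $[c_0,\dots,c_{n-1}]$ of the Kupisch series of $A_1,\dots,A_k$. -}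

module Defs where

open import Data.Nat using (ℕ; zero; suc; _+_; _≤_; _<_)
open import Data.List using (List; []; _∷_; [_]; length; concat)
open import Data.List.Relation.Unary.All using (All)
open import Data.Fin using (Fin; toℕ)
open import Data.Product using (Σ; _×_)
open import Relation.Binary.PropositionalEquality using (_≡_)

-- A list c₀ ∷ … ∷ c_{m-1} is the Kupisch series of a connected linear
-- Nakayama algebra with m ≥ 1 simples iff c_{m-1} = 1 and
-- c_{i+1} + 1 ≥ c_i ≥ 2 for 0 ≤ i < m-1.
data IsConnKupisch : List ℕ → Set where
  last : IsConnKupisch [ 1 ]
  cons : ∀ {c d cs} → 2 ≤ c → c ≤ d + 1 →
         IsConnKupisch (d ∷ cs) → IsConnKupisch (c ∷ d ∷ cs)

-- An element of 𝒜ₙ: an ordered nonempty list of connected linear Nakayama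
-- algebras (each given by its Kupisch series, which determines it up to
-- isomorphism) with n simple modules in total.
record NakProd (n : ℕ) : Set where
  field
    factors     : List (List ℕ)
    nonempty    : 1 ≤ length factors
    connected   : All IsConnKupisch factors
    totalSimple : length (concat factors) ≡ n

kupisch : ∀ {n} → NakProd n → List ℕ
kupisch A = concat (NakProd.factors A)

-- i-th entry of a list of naturals (default 0 out of range; only used for i < n).
at : List ℕ → ℕ → ℕ
at []       _       = 0
at (x ∷ xs) zero    = x
at (x ∷ xs) (suc i) = at xs i

Digraph : ℕ → Set₁
Digraph m = Fin m → Fin m → Set

data Walk {m} (E : Digraph m) : Fin m → Fin m → List (Fin m) → Set where
  here : ∀ {v} → Walk E v v [ v ]
  step : ∀ {u w v vs} → E u w → Walk E w v vs → Walk E u v (u ∷ vs)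

IsRootedTree : ∀ {m} → Digraph m → Fin m → Set
IsRootedTree {m} E r =
  (v : Fin m) → Σ (List (Fin m)) λ vs →
    Walk E r v vs × ((ws : List (Fin m)) → Walk E r v ws → ws ≡ vs)

τ : ∀ {n} → NakProd n → Digraph (suc n)
τ {n} A u v = Σ ℕ λ i → i < n × toℕ v ≡ i × toℕ u ≡ i + at (kupisch A) i

{-# OPTIONS --safe #-}
-- Every vertex i < n of τ(A) has exactly one in-edge, coming from i + cᵢ, and the
-- root n has none. The Kupisch conditions give 0 < cᵢ ≤ n − i, so the unique
-- parent of i is a vertex strictly above i: following parents from any vertex
-- climbs to n, and reading walks backwards shows that they are unique.
module Submission where

open import Defs
open import Data.Nat using (ℕ; zero; suc; _+_; _≤_; _<_; z≤n; s≤s)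
open import Data.Nat.Properties
  using (≤-trans; <-irrefl; m≤m+n; m<m+n; m≤n⇒m<n∨m≡n; +-suc; +-comm; +-monoʳ-≤; <⇒≱; module ≤-Reasoning)
open import Data.Fin using (Fin; toℕ; fromℕ; fromℕ<)
open import Data.Fin.Properties using (toℕ-injective; toℕ-fromℕ; toℕ-fromℕ<; toℕ≤pred[n])
open import Data.List using (List; []; _∷_; [_]; length; concat; _++_)
open import Data.List.Properties using (length-++)
open import Data.List.Relation.Unary.All as All using (All; []; _∷_)
open import Data.Product using (Σ; _×_; _,_; proj₁; proj₂)
open import Data.Sum using (inj₁; inj₂)
open import Data.Empty using (⊥-elim)
open import Relation.Nullary using (¬_)
open import Relation.Binary.PropositionalEquality using (_≡_; refl; sym; trans; cong; subst)

module _ {m} {E : Digraph m} where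

  data Walkʳ : Fin m → Fin m → List (Fin m) → Set where
    here : ∀ {v} → Walkʳ v v [ v ]
    snoc : ∀ {u w v vs} → Walkʳ u w vs → E w v → Walkʳ u v (vs ++ [ v ])

  consʳ : ∀ {u w v vs} → E u w → Walkʳ w v vs → Walkʳ u v (u ∷ vs)
  consʳ e here        = snoc here e
  consʳ e (snoc r e′) = snoc (consʳ e r) e′

  walk⇒walkʳ : ∀ {u v vs} → Walk E u v vs → Walkʳ u v vs
  walk⇒walkʳ here       = here
  walk⇒walkʳ (step e w) = consʳ e (walk⇒walkʳ w)

  snocWalk : ∀ {u w v vs} → Walk E u w vs → E w v → Walk E u v (vs ++ [ v ])
  snocWalk here        e = step e here
  snocWalk (step e′ w) e = step e′ (snocWalk w e)

  module _ (in-unique : ∀ {a b v} → E a v → E b v → a ≡ b)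
           {r : Fin m} (r-source : ∀ {a} → ¬ E a r) where

    walkʳ-unique : ∀ {v vs ws} → Walkʳ r v vs → Walkʳ r v ws → vs ≡ ws
    walkʳ-unique here        here        = refl
    walkʳ-unique here        (snoc _ e)  = ⊥-elim (r-source e)
    walkʳ-unique (snoc _ e)  here        = ⊥-elim (r-source e)
    walkʳ-unique (snoc w e) (snoc w′ e′) with in-unique e e′
    ... | refl = cong (_++ [ _ ]) (walkʳ-unique w w′)

    walk-unique : ∀ {v vs ws} → Walk E r v vs → Walk E r v ws → vs ≡ ws
    walk-unique w w′ = walkʳ-unique (walk⇒walkʳ w) (walk⇒walkʳ w′)

jumpGraph : (n : ℕ) → (ℕ → ℕ) → Digraph (suc n)
jumpGraph n c u v = Σ ℕ λ i → i < n × toℕ v ≡ i × toℕ u ≡ i + c i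

ValidJumps : ℕ → (ℕ → ℕ) → Set
ValidJumps n c = ∀ i → i < n → 0 < c i × i + c i ≤ n

module _ {n : ℕ} {c : ℕ → ℕ} where

  private
    E = jumpGraph n c

  jumpGraph-in-unique : ∀ {a b v} → E a v → E b v → a ≡ b
  jumpGraph-in-unique (i , _ , v≡i , a≡) (j , _ , v≡j , b≡) with trans (sym v≡i) v≡j
  ... | refl = toℕ-injective (trans a≡ (sym b≡))

  jumpGraph-root-source : ∀ {a} → ¬ E a (fromℕ n)
  jumpGraph-root-source (i , i<n , n≡i , _) = <-irrefl (trans (sym n≡i) (toℕ-fromℕ n)) i<n

  -- Fuel: every edge climbs at least one level, so k edges reach the root once n ≤ k + v.
  jumpGraph-walkFromRoot : ValidJumps n c →
    ∀ k (v : Fin (suc n)) → n ≤ k + toℕ v → Σ (List (Fin (suc n))) (Walk E (fromℕ n) v)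
  jumpGraph-walkFromRoot valid k v n≤k+v with m≤n⇒m<n∨m≡n (toℕ≤pred[n] v)
  ... | inj₂ v≡n rewrite toℕ-injective {i = v} {j = fromℕ n} (trans v≡n (sym (toℕ-fromℕ n))) = _ , here
  ... | inj₁ v<n with k | valid (toℕ v) v<n
  ...   | zero  | _            = ⊥-elim (<⇒≱ v<n n≤k+v)
  ...   | suc k | 0<c , jump≤n = _ , snocWalk (proj₂ rest) parent-edge
    where
    i = toℕ v
    parent : Fin (suc n)
    parent = fromℕ< (s≤s jump≤n)
    parent-edge : E parent v
    parent-edge = i , v<n , refl , toℕ-fromℕ< (s≤s jump≤n)
    n≤k+parent : n ≤ k + toℕ parent
    n≤k+parent = begin
      n                ≤⟨ n≤k+v ⟩
      suc k + i        ≡⟨ +-suc k i ⟨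
      k + suc i        ≤⟨ +-monoʳ-≤ k (m<m+n i 0<c) ⟩
      k + (i + c i)    ≡⟨ cong (k +_) (toℕ-fromℕ< (s≤s jump≤n)) ⟨
      k + toℕ parent   ∎
      where open ≤-Reasoning
    rest = jumpGraph-walkFromRoot valid k parent n≤k+parent

  jumpGraph-isRootedTree : ValidJumps n c → IsRootedTree E (fromℕ n)
  jumpGraph-isRootedTree valid v =
    proj₁ walk , proj₂ walk ,
    λ _ w′ → walk-unique jumpGraph-in-unique jumpGraph-root-source w′ (proj₂ walk)
    where
    walk = jumpGraph-walkFromRoot valid n v (m≤m+n n (toℕ v))

data SuffixBounded : List ℕ → Set where
  []  : SuffixBounded []
  _∷_ : ∀ {c cs} → 0 < c × c ≤ suc (length cs) → SuffixBounded cs → SuffixBounded (c ∷ cs)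

suffixBounded-++ : ∀ {xs ys} → SuffixBounded xs → SuffixBounded ys → SuffixBounded (xs ++ ys)
suffixBounded-++ [] b = b
suffixBounded-++ {_ ∷ xs} {ys} ((0<x , x≤) ∷ a) b =
  (0<x , ≤-trans x≤ (s≤s (subst (length xs ≤_) (sym (length-++ xs)) (m≤m+n _ _))))
  ∷ suffixBounded-++ a b

suffixBounded-concat : ∀ {xss} → All SuffixBounded xss → SuffixBounded (concat xss)
suffixBounded-concat []       = []
suffixBounded-concat (a ∷ as) = suffixBounded-++ a (suffixBounded-concat as)

isConnKupisch⇒suffixBounded : ∀ {cs} → IsConnKupisch cs → SuffixBounded cs
isConnKupisch⇒suffixBounded last = (s≤s z≤n , s≤s z≤n) ∷ []
isConnKupisch⇒suffixBounded (cons {c} {d} {cs} 2≤c c≤d+1 k) with isConnKupisch⇒suffixBounded k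
... | b@((_ , d≤) ∷ _) = (≤-trans (s≤s z≤n) 2≤c , c≤) ∷ b
  where
  c≤ : c ≤ 2 + length cs
  c≤ = ≤-trans c≤d+1 (subst (_≤ 2 + length cs) (+-comm 1 d) (s≤s d≤))

suffixBounded⇒validJumps : ∀ {cs} → SuffixBounded cs → ValidJumps (length cs) (at cs)
suffixBounded⇒validJumps ((0<c , c≤) ∷ _) zero    _         = 0<c , c≤
suffixBounded⇒validJumps (_ ∷ b)          (suc i) (s≤s i<n) with suffixBounded⇒validJumps b i i<n
... | 0<c , jump≤n = 0<c , s≤s jump≤n

kupisch-validJumps : ∀ {n} (A : NakProd n) → ValidJumps n (at (kupisch A))
kupisch-validJumps A = subst (λ n → ValidJumps n (at (kupisch A))) (NakProd.totalSimple A)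
  (suffixBounded⇒validJumps
    (suffixBounded-concat (All.map isConnKupisch⇒suffixBounded (NakProd.connected A))))

lemma3p1 : (n : ℕ) (A : NakProd n) → IsRootedTree (τ A) (fromℕ n)
lemma3p1 n A = jumpGraph-isRootedTree (kupisch-validJumps A)
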